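{- For every tree $T=(V,E)$ of order at least $3$ with maximum degree $\Delta(T)$, $$\sum_{uv\in E}|d(u)-d(v)| \;\ge\; \sum_{v\in V}(d(v)-2)^2 + 2(\Delta(T)-2).$$
   Context: $d(v)$ denotes the degree of vertex $v$ in $T$, and $\Delta(T)$ is the maximum degree of $T$. -}

module Defs where

open import Data.Bool using (Bool; true; false; T; if_then_else_)
open import Data.Nat using (ℕ; zero; suc; _⊔_; _≤_; ∣_-_∣)
open import Data.Fin using (Fin; toℕ; _<?_)
open import Data.List using (List; []; _∷_; _++_; map; foldr; length; allFin)
open import Data.Nat.ListAction using (sum)
open import Data.List.Relation.Unary.Unique.Propositional using (Unique)
open import Data.List.Relation.Unary.Linked using (Linked)
open import Data.Product using (Σ; _×_)
open import Relation.Nullary using (¬_; does)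
open import Relation.Binary.PropositionalEquality using (_≡_)
open import Data.Integer as ℤ using (ℤ; +_)

record Graph (n : ℕ) : Set where
  field
    adj    : Fin n → Fin n → Bool
    sym    : ∀ u v → adj u v ≡ adj v u
    irrefl : ∀ v → adj v v ≡ false

module _ {n : ℕ} (G : Graph n) where
  open Graph G

  Adj : Fin n → Fin n → Set
  Adj u v = T (adj u v)

  data Reach : Fin n → Fin n → Set where
    here : ∀ {u} → Reach u u
    step : ∀ {u w v} → Adj u w → Reach w v → Reach u v

  Connected : Set
  Connected = ∀ u v → Reach u v

  -- a cycle: distinct vertices x, x₁, …, x_k (k ≥ 2, so length ≥ 3),
  -- consecutive ones adjacent, and x_k adjacent to x
  IsCycle : List (Fin n) → Set
  IsCycle [] = Data.Empty.⊥ where import Data.Empty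
  IsCycle (x ∷ xs) = (2 ≤ length xs) × Unique (x ∷ xs) × Linked Adj (x ∷ xs ++ x ∷ [])

  Acyclic : Set
  Acyclic = ∀ c → ¬ IsCycle c

  IsTree : Set
  IsTree = Connected × Acyclic

  deg : Fin n → ℕ
  deg v = sum (map (λ u → if adj v u then 1 else 0) (allFin n))

  maxDeg : ℕ
  maxDeg = foldr _⊔_ 0 (map deg (allFin n))

  edgeSum : ℕ
  edgeSum = sum (map (λ u → sum (map (λ v →
              if adj u v then (if does (u <? v) then ∣ deg u - deg v ∣ else 0) else 0)
              (allFin n))) (allFin n))

  vertexSum : ℤ
  vertexSum = foldr ℤ._+_ (+ 0) (map (λ v → (+ deg v ℤ.- + 2) ℤ.* (+ deg v ℤ.- + 2)) (allFin n))

{-# OPTIONS --safe #-}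
-- Root the tree at a vertex r of maximum degree and send every other vertex u to its parent
-- p u, a neighbour one step closer to r.  Acyclicity makes the edges exactly the pairs
-- {u, p u}, so d v = [v ≠ r] + c v, where c v counts the children of v.  Substituting this
-- into (d v − 2)² and regrouping the children terms along parent edges, the vertex sum
-- telescopes:
--   Σ_v (d v − 2)² + 2 (d r − 2) = Σ_{u ≠ r} (d (p u) − d u) ≤ Σ_{u ≠ r} |d u − d (p u)|,
-- and the right-hand side is the edge sum.
module Submission where

open import Defs
open import Data.Nat using (ℕ)
open import Data.Integer using (+_; _+_; _-_; _*_)
import Data.Nat
import Data.Integer

open import Data.Bool using (Bool; true; false; T; if_then_else_)
open import Data.Empty using (⊥-elim)
open import Data.Fin using (Fin; zero; suc; _<?_)
open import Data.Fin.Properties as Fin using (_≟_; any?)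
open import Data.Integer using (ℤ; 0ℤ; 1ℤ; _≤_; +≤+; -_; _⊖_)
open import Data.Integer.Properties
  using (+-*-semiring; pos-+; +-identityˡ; +-identityʳ; *-identityˡ; *-identityʳ; *-assoc; *-comm;
         *-distribˡ-+; *-distribʳ-+; ≤-refl; ≤-reflexive; ≤-trans; +-mono-≤; +-monoʳ-≤; +-monoˡ-≤;
         *-monoˡ-≤-nonNeg; m-n≡m⊖n; ⊖-≥; i≤j⇒i-j≤0; module ≤-Reasoning)
open import Data.Integer.Tactic.RingSolver using (solve-∀)
open import Data.List using (List; []; _∷_; _++_; map; foldr; drop; reverse; length; tabulate; allFin)
open import Data.List.Properties using (map-tabulate; unfold-reverse; foldr-preservesᵇ)
open import Data.List.Membership.Propositional using (_∈_; _∉_)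
open import Data.List.Membership.Propositional.Properties using (∈-++⁻; ∈-allFin)
import Data.List.Membership.DecPropositional as DecMembership
open import Data.List.Relation.Unary.All as All using ([])
open import Data.List.Relation.Unary.All.Properties as Allₚ using (¬Any⇒All¬)
open import Data.List.Extrema.Nat using (f[xs]≤f[argmax])
open import Data.List.Relation.Unary.Any using (here; there)
open import Data.List.Relation.Unary.Any.Properties using (reverse⁻)
open import Data.List.Relation.Unary.AllPairs using ([]; _∷_)
open import Data.List.Relation.Unary.Unique.Propositional using (Unique)
open import Data.List.Relation.Unary.Unique.Propositional.Properties using (drop⁺)
open import Data.List.Relation.Unary.Linked using (Linked; [-]; _∷_)
open import Data.List.Relation.Binary.Subset.Propositional using (_⊆_)
open import Data.List.Relation.Binary.Subset.Propositional.Properties using (∷⁺ʳ)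
import Data.List.Relation.Binary.Sublist.Propositional.Properties as Sublist
open import Data.Nat as ℕ using (zero; suc; _<_; z≤n; s≤s; ∣_-_∣)
import Data.Nat.Properties as ℕ
import Data.Vec.Functional as Vector
open import Data.Product using (∃; _×_; _,_; proj₁; proj₂)
open import Data.Sum as Sum using (_⊎_; inj₁; inj₂)
open import Function using (_∘_; id)
open import Relation.Nullary using (¬_; Dec; yes; no; does; contradiction)
open import Relation.Nullary.Decidable using (dec-true; dec-false; decidable-stable; T?; _×-dec_)
open import Relation.Unary using (Decidable)
open import Relation.Binary.Definitions using (tri<; tri≈; tri>)
open import Relation.Binary.PropositionalEquality
  using (_≡_; _≢_; refl; sym; trans; cong; cong₂; subst; subst₂; module ≡-Reasoning)

open import Algebra.Properties.Semiring.Sum +-*-semiring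
  using (sum-syntax; sum-cong-≗; sum-replicate-zero; ∑-distrib-+; ∑-comm; *-distribˡ-sum)

least-witness : ∀ {p} {P : ℕ → Set p} → Decidable P → ∀ {m} → P m →
                ∃ λ k → P k × (∀ {j} → P j → k ℕ.≤ j)
least-witness P? {m} Pm with P? 0
... | yes P0 = 0 , P0 , λ _ → z≤n
least-witness P? {zero}  P0 | no ¬P0 = contradiction P0 ¬P0
least-witness P? {suc m} Pm | no ¬P0 with least-witness (P? ∘ suc) Pm
... | k , Pk , least =
  suc k , Pk , λ { {zero} P0 → contradiction P0 ¬P0 ; {suc j} Pj → s≤s (least Pj) }

foldr-tabulate : ∀ {a b} {A : Set a} {B : Set b} (_∙_ : A → B → B) (e : B) {n} (f : Fin n → A) →
                 foldr _∙_ e (tabulate f) ≡ Vector.foldr _∙_ e f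
foldr-tabulate _∙_ e {zero}  f = refl
foldr-tabulate _∙_ e {suc n} f = cong (f zero ∙_) (foldr-tabulate _∙_ e (f ∘ suc))

foldr-map-allFin : ∀ {a b} {A : Set a} {B : Set b} (_∙_ : A → B → B) (e : B) {n} (f : Fin n → A) →
                   foldr _∙_ e (map f (allFin n)) ≡ Vector.foldr _∙_ e f
foldr-map-allFin _∙_ e f = trans (cong (foldr _∙_ e) (map-tabulate id f)) (foldr-tabulate _∙_ e f)

pos-∑ : ∀ {n} (f : Fin n → ℕ) → + (Vector.foldr ℕ._+_ 0 f) ≡ ∑[ i < n ] (+ f i)
pos-∑ {zero}  f = refl
pos-∑ {suc n} f = trans (pos-+ (f zero) _) (cong (λ s → + f zero + s) (pos-∑ (f ∘ suc)))

pos-sum-allFin : ∀ {n} (f : Fin n → ℕ) → + (foldr ℕ._+_ 0 (map f (allFin n))) ≡ ∑[ i < n ] (+ f i)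
pos-sum-allFin f = trans (cong +_ (foldr-map-allFin ℕ._+_ 0 f)) (pos-∑ f)

∑-mono-≤ : ∀ {n} {f g : Fin n → ℤ} → (∀ i → f i ≤ g i) → ∑[ i < n ] f i ≤ ∑[ i < n ] g i
∑-mono-≤ {zero}  f≤g = ≤-refl
∑-mono-≤ {suc n} f≤g = +-mono-≤ (f≤g zero) (∑-mono-≤ (f≤g ∘ suc))

-- Cast from ℕ so that the summands of deg in Defs are 𝟙 (adj v u) definitionally.
𝟙 : Bool → ℤ
𝟙 b = + (if b then 1 else 0)

pos-if : ∀ b x → + (if b then x else 0) ≡ 𝟙 b * + x
pos-if true  x = sym (*-identityˡ (+ x))
pos-if false x = refl

δ : ∀ {n} → Fin n → Fin n → ℤ
δ i j = 𝟙 (does (i ≟ j))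

δ-refl : ∀ {n} (i : Fin n) → δ i i ≡ 1ℤ
δ-refl i = cong 𝟙 (dec-true (i ≟ i) refl)

δ-≢ : ∀ {n} {i j : Fin n} → i ≢ j → δ i j ≡ 0ℤ
δ-≢ {i = i} {j} i≢j = cong 𝟙 (dec-false (i ≟ j) i≢j)

∑-δ : ∀ {n} (i : Fin n) (f : Fin n → ℤ) → ∑[ j < n ] (δ i j * f j) ≡ f i
∑-δ {suc n} zero    f = begin
  1ℤ * f zero + ∑[ j < n ] 0ℤ    ≡⟨ cong₂ _+_ (*-identityˡ (f zero)) (sum-replicate-zero n) ⟩
  f zero + 0ℤ                     ≡⟨ +-identityʳ (f zero) ⟩
  f zero                          ∎
  where open ≡-Reasoning
∑-δ {suc n} (suc i) f = trans (+-identityˡ _) (∑-δ i (f ∘ suc))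

n-m≤∣m-n∣ : ∀ m n → + n - + m ≤ + ∣ m - n ∣
n-m≤∣m-n∣ m n with ℕ.≤-total m n
... | inj₁ m≤n = ≤-reflexive (begin
  + n - + m    ≡⟨ m-n≡m⊖n n m ⟩
  n ⊖ m        ≡⟨ ⊖-≥ m≤n ⟩
  + (n ℕ.∸ m)  ≡⟨ cong +_ (ℕ.m≤n⇒∣m-n∣≡n∸m m≤n) ⟨
  + ∣ m - n ∣  ∎)
  where open ≡-Reasoning
... | inj₂ n≤m = ≤-trans (i≤j⇒i-j≤0 (+≤+ n≤m)) (+≤+ z≤n)

orientation-sum : ∀ {n} (w : Fin n → Fin n → ℕ) → (∀ u v → w u v ≡ w v u) → ∀ {u v} → u ≢ v →
                  + (if does (u <? v) then w u v else 0) + + (if does (v <? u) then w v u else 0) ≡ + w u v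
orientation-sum w w-sym {u} {v} u≢v with Fin.<-cmp u v
... | tri< u<v _ v≮u rewrite dec-true (u <? v) u<v | dec-false (v <? u) v≮u = +-identityʳ (+ w u v)
... | tri≈ _ u≡v _   = contradiction u≡v u≢v
... | tri> u≮v _ v<u rewrite dec-false (u <? v) u≮v | dec-true (v <? u) v<u = cong +_ (w-sym v u)

module Walks {n : ℕ} (G : Graph n) where
  open DecMembership (_≟_ {n}) using (_∈?_)

  Adj-sym : ∀ {a b} → Adj G a b → Adj G b a
  Adj-sym {a} {b} = subst T (Graph.sym G a b)

  Adj-irrefl : ∀ {a} → ¬ Adj G a a
  Adj-irrefl {a} = subst T (Graph.irrefl G a)

  data Walk : Fin n → Fin n → List (Fin n) → Set where
    [_] : ∀ a → Walk a a (a ∷ [])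
    _∷_ : ∀ {a b c xs} → Adj G a b → Walk b c xs → Walk a c (a ∷ xs)

  _++ʷ_ : ∀ {a b c xs ys} → Walk a b xs → Walk b c ys → Walk a c (xs ++ drop 1 ys)
  [ a ] ++ʷ [ _ ]   = [ a ]
  [ a ] ++ʷ (e ∷ w) = e ∷ w
  (e ∷ w) ++ʷ w′    = e ∷ (w ++ʷ w′)

  reverseʷ : ∀ {a b xs} → Walk a b xs → Walk b a (reverse xs)
  reverseʷ [ a ] = [ a ]
  reverseʷ {a} {xs = _ ∷ xs} (e ∷ w) =
    subst (Walk _ a) (sym (unfold-reverse a xs)) (reverseʷ w ++ʷ (Adj-sym e ∷ [ a ]))

  suffix-from : ∀ {a b c xs} → Walk a c xs → b ∈ xs → ∃ λ k → Walk b c (drop k xs)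
  suffix-from [ _ ]   (here refl)  = 0 , [ _ ]
  suffix-from (e ∷ w) (here refl)  = 0 , e ∷ w
  suffix-from (_ ∷ w) (there b∈xs) = let k , w′ = suffix-from w b∈xs in suc k , w′

  walk⇒path : ∀ {a b xs} → Walk a b xs → ∃ λ ys → Walk a b ys × Unique ys × ys ⊆ xs
  walk⇒path [ a ] = _ , [ a ] , [] ∷ [] , id
  walk⇒path {a} (e ∷ w) with walk⇒path w
  ... | ys , p , ys! , ys⊆xs with a ∈? ys
  ...   | yes a∈ys = let k , p′ = suffix-from p a∈ys in
    drop k ys , p′ , drop⁺ k ys! , there ∘ ys⊆xs ∘ Sublist.Any-resp-⊆ (Sublist.drop-⊆ k ys)
  ...   | no a∉ys = a ∷ ys , e ∷ p , ¬Any⇒All¬ ys a∉ys ∷ ys! , ∷⁺ʳ a ys⊆xs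

  walk-length : ∀ {a b xs} → Walk a b xs → a ≢ b → 2 ℕ.≤ length xs
  walk-length [ _ ]         a≢a = contradiction refl a≢a
  walk-length (_ ∷ [ _ ])   _   = s≤s (s≤s z≤n)
  walk-length (_ ∷ (_ ∷ _)) _   = s≤s (s≤s z≤n)

  closing-linked : ∀ {a b c d xs} → Adj G d a → Walk a b xs → Adj G b c →
                   Linked (Adj G) (d ∷ xs ++ c ∷ [])
  closing-linked da [ _ ]   bc = da ∷ bc ∷ [-]
  closing-linked da (e ∷ w) bc = da ∷ closing-linked e w bc

  acyclic⇒walk-visits : Acyclic G → ∀ {a b c xs} → Adj G c a → Adj G b c → a ≢ b →
                        Walk a b xs → c ∈ xs
  acyclic⇒walk-visits acyclic {c = c} {xs} ca bc a≢b w with c ∈? xs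
  ... | yes c∈xs = c∈xs
  ... | no c∉xs  =
    let ys , p , ys! , ys⊆xs = walk⇒path w in
    ⊥-elim (acyclic (c ∷ ys)
      (walk-length p a≢b , ¬Any⇒All¬ ys (c∉xs ∘ ys⊆xs) ∷ ys! , closing-linked ca p bc))

module Rooted {n : ℕ} (G : Graph n) (connected : Connected G) (r : Fin n) where
  open Walks G

  ReachesRootIn : ℕ → Fin n → Set
  ReachesRootIn zero    v = v ≡ r
  ReachesRootIn (suc k) v = ∃ λ u → Adj G v u × ReachesRootIn k u

  reachesRootIn? : ∀ k → Decidable (ReachesRootIn k)
  reachesRootIn? zero    v = v ≟ r
  reachesRootIn? (suc k) v = any? λ u → T? (Graph.adj G v u) ×-dec reachesRootIn? k u

  reach⇒reachesRootIn : ∀ {v} → Reach G v r → ∃ λ k → ReachesRootIn k v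
  reach⇒reachesRootIn here          = 0 , refl
  reach⇒reachesRootIn (step vu u⇝r) = let k , u⇝ = reach⇒reachesRootIn u⇝r in suc k , _ , vu , u⇝

  private
    shortest : ∀ v → ∃ λ k → ReachesRootIn k v × (∀ {j} → ReachesRootIn j v → k ℕ.≤ j)
    shortest v = least-witness (λ k → reachesRootIn? k v) (proj₂ (reach⇒reachesRootIn (connected v r)))

  depth : Fin n → ℕ
  depth v = proj₁ (shortest v)

  reaches-depth : ∀ v → ReachesRootIn (depth v) v
  reaches-depth v = proj₁ (proj₂ (shortest v))

  depth-minimal : ∀ {k v} → ReachesRootIn k v → depth v ℕ.≤ k
  depth-minimal {v = v} = proj₂ (proj₂ (shortest v))

  depth-root : depth r ≡ 0
  depth-root = ℕ.n≤0⇒n≡0 (depth-minimal refl)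

  closer-neighbour : ∀ {k v} → ReachesRootIn k v → v ≢ r → ∃ λ u → Adj G v u × depth u < k
  closer-neighbour {zero}  v≡r          v≢r = contradiction v≡r v≢r
  closer-neighbour {suc k} (u , vu , u⇝) _  = u , vu , s≤s (depth-minimal u⇝)

  -- The decision is an argument because a `with v ≟ r` would also abstract the v ≟ r
  -- hidden inside depth v (the first step of its least-witness search).
  private
    parent-step : ∀ v → Dec (v ≡ r) → ∃ λ u → v ≢ r → Adj G v u × depth u < depth v
    parent-step v (yes v≡r) = r , λ v≢r → contradiction v≡r v≢r
    parent-step v (no v≢r)  =
      let u , vu , du<dv = closer-neighbour (reaches-depth v) v≢r in u , λ _ → vu , du<dv

  parent : Fin n → Fin n
  parent v = proj₁ (parent-step v (v ≟ r))

  parent-adj : ∀ {v} → v ≢ r → Adj G v (parent v)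
  parent-adj {v} v≢r = proj₁ (proj₂ (parent-step v (v ≟ r)) v≢r)

  parent-depth : ∀ {v} → v ≢ r → depth (parent v) < depth v
  parent-depth {v} v≢r = proj₂ (proj₂ (parent-step v (v ≟ r)) v≢r)

  parent-≢ : ∀ {v} → v ≢ r → parent v ≢ v
  parent-≢ v≢r pv≡v = ℕ.<-irrefl (cong depth pv≡v) (parent-depth v≢r)

  parent-asym : ∀ {u v} → u ≢ r → parent u ≡ v → v ≢ r → parent v ≢ u
  parent-asym {u} u≢r refl pu≢r ppu≡u =
    ℕ.<-asym (parent-depth u≢r) (subst (λ w → depth w < depth (parent u)) ppu≡u (parent-depth pu≢r))

  walk-to-root : ∀ {k v} → ReachesRootIn k v →
                 ∃ λ xs → Walk v r xs × (∀ {y} → y ≢ v → k ℕ.≤ depth y → y ∉ xs)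
  -- The vertices after v reach r in fewer than k steps, so they are shallower than y.
  walk-to-root {zero} refl = _ , [ r ] , λ { y≢r _ (here y≡r) → y≢r y≡r }
  walk-to-root {suc k} (u , vu , u⇝) =
    let xs , w , avoids = walk-to-root u⇝ in
    _ , vu ∷ w , λ where
      y≢v _    (here y≡v)   → y≢v y≡v
      _   k<dy (there y∈xs) →
        avoids (λ { refl → ℕ.<⇒≱ k<dy (depth-minimal u⇝) }) (ℕ.<⇒≤ k<dy) y∈xs

  walk-via-root : ∀ a b → ∃ λ xs → Walk a b xs ×
                  (∀ {y} → y ≢ a → y ≢ b → depth a ℕ.≤ depth y → depth b ℕ.≤ depth y → y ∉ xs)
  walk-via-root a b =
    let xs , wa , avoids-a = walk-to-root (reaches-depth a)
        ys , wb , avoids-b = walk-to-root (reaches-depth b)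
    in _ , wa ++ʷ reverseʷ wb , λ y≢a y≢b da≤dy db≤dy y∈ →
      Sum.[ avoids-a y≢a da≤dy
          , avoids-b y≢b db≤dy ∘ reverse⁻ ∘ Sublist.Any-resp-⊆ (Sublist.drop-⊆ 1 (reverse ys))
          ] (∈-++⁻ xs y∈)

module RootedTree {n : ℕ} (G : Graph n) (tree : IsTree G) (r : Fin n) where
  open Graph G using (adj)
  open Walks G
  open Rooted G (proj₁ tree) r

  deeper-end-is-child : ∀ {u v} → Adj G u v → depth u ℕ.≤ depth v → v ≢ r × parent v ≡ u
  deeper-end-is-child {u} {v} uv du≤dv = v≢r , decidable-stable (parent v ≟ u) pv≢u-absurd
    where
    u≢v : u ≢ v
    u≢v refl = Adj-irrefl uv
    v≢r : v ≢ r
    v≢r refl = ℕ.n≮0 (ℕ.<-≤-trans (parent-depth u≢v) (subst (depth u ℕ.≤_) depth-root du≤dv))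
    -- Otherwise the walk from p v to u through the root avoids v and closes a cycle with v.
    pv≢u-absurd : ¬ parent v ≢ u
    pv≢u-absurd pv≢u =
      let xs , w , avoids = walk-via-root (parent v) u in
      avoids (parent-≢ v≢r ∘ sym) (u≢v ∘ sym) (ℕ.<⇒≤ (parent-depth v≢r)) du≤dv
             (acyclic⇒walk-visits (proj₂ tree) (parent-adj v≢r) uv pv≢u w)

  tree-edge : ∀ {u v} → Adj G u v → (u ≢ r × parent u ≡ v) ⊎ (v ≢ r × parent v ≡ u)
  tree-edge {u} {v} uv with ℕ.≤-total (depth u) (depth v)
  ... | inj₁ du≤dv = inj₂ (deeper-end-is-child uv du≤dv)
  ... | inj₂ dv≤du = inj₁ (deeper-end-is-child (Adj-sym uv) dv≤du)

  nonRoot : Fin n → ℤ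
  nonRoot v = 1ℤ - δ r v

  nonRoot-mono : ∀ {v x y} → (v ≢ r → x ≤ y) → nonRoot v * x ≤ nonRoot v * y
  nonRoot-mono {v} {x} {y} x≤y with r ≟ v
  ... | yes _   = ≤-refl
  ... | no r≢v = subst₂ _≤_ (sym (*-identityˡ x)) (sym (*-identityˡ y)) (x≤y (r≢v ∘ sym))

  child : Fin n → Fin n → ℤ
  child u v = nonRoot u * δ (parent u) v

  children : Fin n → ℤ
  children v = ∑[ u < n ] child u v

  child≡1 : ∀ {u v} → u ≢ r → parent u ≡ v → child u v ≡ 1ℤ
  child≡1 {u} u≢r refl with r ≟ u
  ... | yes r≡u = contradiction (sym r≡u) u≢r
  ... | no _    = cong (1ℤ *_) (δ-refl (parent u))

  child≡0 : ∀ {u v} → (u ≢ r → parent u ≢ v) → child u v ≡ 0ℤ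
  child≡0 {u} not-child with r ≟ u
  ... | yes _   = refl
  ... | no r≢u = cong (1ℤ *_) (δ-≢ (not-child (r≢u ∘ sym)))

  adjacency-split : ∀ u v → 𝟙 (adj u v) ≡ child u v + child v u
  adjacency-split u v with adj u v in uv
  ... | true with tree-edge (subst T (sym uv) _)
  ...   | inj₁ (u≢r , pu≡v) = sym (cong₂ _+_ (child≡1 u≢r pu≡v) (child≡0 (parent-asym u≢r pu≡v)))
  ...   | inj₂ (v≢r , pv≡u) = sym (cong₂ _+_ (child≡0 (parent-asym v≢r pv≡u)) (child≡1 v≢r pv≡u))
  adjacency-split u v | false =
    sym (cong₂ _+_ (child≡0 (parent-not-adj ¬uv)) (child≡0 (parent-not-adj (¬uv ∘ Adj-sym))))
    where
    ¬uv : ¬ Adj G u v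
    ¬uv = subst T uv
    parent-not-adj : ∀ {a b} → ¬ Adj G a b → a ≢ r → parent a ≢ b
    parent-not-adj ¬ab a≢r refl = ¬ab (parent-adj a≢r)

  ∑-child : ∀ u (f : Fin n → ℤ) → ∑[ v < n ] (child u v * f v) ≡ nonRoot u * f (parent u)
  ∑-child u f = begin
    ∑[ v < n ] (child u v * f v)
      ≡⟨ sum-cong-≗ (λ v → *-assoc (nonRoot u) (δ (parent u) v) (f v)) ⟩
    ∑[ v < n ] (nonRoot u * (δ (parent u) v * f v))
      ≡⟨ *-distribˡ-sum (nonRoot u) (λ v → δ (parent u) v * f v) ⟨
    nonRoot u * ∑[ v < n ] (δ (parent u) v * f v)
      ≡⟨ cong (nonRoot u *_) (∑-δ (parent u) f) ⟩
    nonRoot u * f (parent u)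
      ∎
    where open ≡-Reasoning

  ∑-children : ∀ (f : Fin n → ℤ) →
               ∑[ v < n ] (f v * children v) ≡ ∑[ u < n ] (nonRoot u * f (parent u))
  ∑-children f = begin
    ∑[ v < n ] (f v * children v)
      ≡⟨ sum-cong-≗ (λ v → *-distribˡ-sum (f v) (λ u → child u v)) ⟩
    ∑[ v < n ] ∑[ u < n ] (f v * child u v)
      ≡⟨ ∑-comm (λ v u → f v * child u v) ⟩
    ∑[ u < n ] ∑[ v < n ] (f v * child u v)
      ≡⟨ sum-cong-≗ (λ u → sum-cong-≗ (λ v → *-comm (f v) (child u v))) ⟩
    ∑[ u < n ] ∑[ v < n ] (child u v * f v)
      ≡⟨ sum-cong-≗ (λ u → ∑-child u f) ⟩
    ∑[ u < n ] (nonRoot u * f (parent u))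
      ∎
    where open ≡-Reasoning

  ∑-adjacent : ∀ (F : Fin n → Fin n → ℤ) →
               ∑[ u < n ] ∑[ v < n ] (𝟙 (adj u v) * F u v) ≡
               ∑[ u < n ] (nonRoot u * (F u (parent u) + F (parent u) u))
  ∑-adjacent F = begin
    ∑[ u < n ] ∑[ v < n ] (𝟙 (adj u v) * F u v)
      ≡⟨ sum-cong-≗ (λ u → sum-cong-≗ (λ v → cong (_* F u v) (adjacency-split u v))) ⟩
    ∑[ u < n ] ∑[ v < n ] ((child u v + child v u) * F u v)
      ≡⟨ sum-cong-≗ split-row ⟩
    ∑[ u < n ] (∑[ v < n ] (child u v * F u v) + ∑[ v < n ] (child v u * F u v))
      ≡⟨ ∑-distrib-+ (λ u → ∑[ v < n ] (child u v * F u v)) (λ u → ∑[ v < n ] (child v u * F u v)) ⟩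
    ∑[ u < n ] ∑[ v < n ] (child u v * F u v) + ∑[ u < n ] ∑[ v < n ] (child v u * F u v)
      ≡⟨ cong₂ _+_ (sum-cong-≗ (λ u → ∑-child u (F u)))
                   (trans (∑-comm (λ u v → child v u * F u v))
                          (sum-cong-≗ (λ v → ∑-child v (λ u → F u v)))) ⟩
    ∑[ u < n ] (nonRoot u * F u (parent u)) + ∑[ u < n ] (nonRoot u * F (parent u) u)
      ≡⟨ ∑-distrib-+ (λ u → nonRoot u * F u (parent u)) (λ u → nonRoot u * F (parent u) u) ⟨
    ∑[ u < n ] (nonRoot u * F u (parent u) + nonRoot u * F (parent u) u)
      ≡⟨ sum-cong-≗ (λ u → *-distribˡ-+ (nonRoot u) (F u (parent u)) (F (parent u) u)) ⟨
    ∑[ u < n ] (nonRoot u * (F u (parent u) + F (parent u) u))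
      ∎
    where
    open ≡-Reasoning
    split-row : ∀ u → ∑[ v < n ] ((child u v + child v u) * F u v) ≡
                      ∑[ v < n ] (child u v * F u v) + ∑[ v < n ] (child v u * F u v)
    split-row u = trans (sum-cong-≗ (λ v → *-distribʳ-+ (F u v) (child u v) (child v u)))
                        (∑-distrib-+ (λ v → child u v * F u v) (λ v → child v u * F u v))

  degree-split : ∀ v → + deg G v ≡ nonRoot v + children v
  degree-split v = begin
    + deg G v                                         ≡⟨ pos-sum-allFin (λ u → if adj v u then 1 else 0) ⟩
    ∑[ u < n ] 𝟙 (adj v u)                            ≡⟨ sum-cong-≗ (adjacency-split v) ⟩
    ∑[ u < n ] (child v u + child u v)                ≡⟨ ∑-distrib-+ (child v) (λ u → child u v) ⟩
    ∑[ u < n ] child v u + children v                 ≡⟨ cong (_+ children v) edge-to-parent ⟩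
    nonRoot v + children v                            ∎
    where
    open ≡-Reasoning
    edge-to-parent : ∑[ u < n ] child v u ≡ nonRoot v
    edge-to-parent = begin
      ∑[ u < n ] child v u          ≡⟨ sum-cong-≗ (λ u → *-identityʳ (child v u)) ⟨
      ∑[ u < n ] (child v u * 1ℤ)   ≡⟨ ∑-child v (λ _ → 1ℤ) ⟩
      nonRoot v * 1ℤ                ≡⟨ *-identityʳ (nonRoot v) ⟩
      nonRoot v                     ∎

  vertexSum-via-parents : vertexSum G + + 2 * (+ deg G r - + 2) ≡
                          ∑[ u < n ] (nonRoot u * (+ deg G (parent u) - + deg G u))
  vertexSum-via-parents = begin
    vertexSum G + + 2 * (D r - + 2)
      ≡⟨ cong₂ _+_ (foldr-map-allFin _+_ 0ℤ (λ v → (D v - + 2) * (D v - + 2)))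
                   (sym (∑-δ r (λ v → + 2 * (D v - + 2)))) ⟩
    ∑[ v < n ] ((D v - + 2) * (D v - + 2)) + ∑[ v < n ] (δ r v * (+ 2 * (D v - + 2)))
      ≡⟨ ∑-distrib-+ (λ v → (D v - + 2) * (D v - + 2)) (λ v → δ r v * (+ 2 * (D v - + 2))) ⟨
    ∑[ v < n ] ((D v - + 2) * (D v - + 2) + δ r v * (+ 2 * (D v - + 2)))
      ≡⟨ sum-cong-≗ local-split ⟩
    ∑[ v < n ] ((D v - + 2) * children v + nonRoot v * (+ 2 - D v))
      ≡⟨ ∑-distrib-+ (λ v → (D v - + 2) * children v) (λ v → nonRoot v * (+ 2 - D v)) ⟩
    ∑[ v < n ] ((D v - + 2) * children v) + ∑[ v < n ] (nonRoot v * (+ 2 - D v))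
      ≡⟨ cong (_+ ∑[ v < n ] (nonRoot v * (+ 2 - D v))) (∑-children (λ v → D v - + 2)) ⟩
    ∑[ u < n ] (nonRoot u * (D (parent u) - + 2)) + ∑[ u < n ] (nonRoot u * (+ 2 - D u))
      ≡⟨ ∑-distrib-+ (λ u → nonRoot u * (D (parent u) - + 2)) (λ u → nonRoot u * (+ 2 - D u)) ⟨
    ∑[ u < n ] (nonRoot u * (D (parent u) - + 2) + nonRoot u * (+ 2 - D u))
      ≡⟨ sum-cong-≗ (λ u → *-telescope (nonRoot u) (D (parent u)) (D u)) ⟩
    ∑[ u < n ] (nonRoot u * (D (parent u) - D u))
      ∎
    where
    open ≡-Reasoning
    D : Fin n → ℤ
    D v = + deg G v
    -- d is the root indicator δ r v and c = children v, so that 1 - d + c is the degree.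
    square-split : ∀ d c → let D = 1ℤ - d + c in
                   (D - + 2) * (D - + 2) + d * (+ 2 * (D - + 2)) ≡ (D - + 2) * c + (1ℤ - d) * (+ 2 - D)
    square-split = solve-∀
    *-telescope : ∀ e p q → e * (p - + 2) + e * (+ 2 - q) ≡ e * (p - q)
    *-telescope = solve-∀
    local-split : ∀ v → (D v - + 2) * (D v - + 2) + δ r v * (+ 2 * (D v - + 2)) ≡
                        (D v - + 2) * children v + nonRoot v * (+ 2 - D v)
    local-split v = begin
      (D v - + 2) * (D v - + 2) + δ r v * (+ 2 * (D v - + 2))
        ≡⟨ cong (λ x → (x - + 2) * (x - + 2) + δ r v * (+ 2 * (x - + 2))) (degree-split v) ⟩
      _ ≡⟨ square-split (δ r v) (children v) ⟩
      _ ≡⟨ cong (λ x → (x - + 2) * children v + nonRoot v * (+ 2 - x)) (degree-split v) ⟨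
      (D v - + 2) * children v + nonRoot v * (+ 2 - D v)
        ∎

  degree-gap : Fin n → Fin n → ℕ
  degree-gap u v = ∣ deg G u - deg G v ∣

  -- edgeSum counts the edge {u, v} once, through its orientation with u < v.
  gap : Fin n → Fin n → ℤ
  gap u v = + (if does (u <? v) then degree-gap u v else 0)

  edgeSum-via-parents : + edgeSum G ≡ ∑[ u < n ] (nonRoot u * (gap u (parent u) + gap (parent u) u))
  edgeSum-via-parents = begin
    + edgeSum G
      ≡⟨ pos-sum-allFin (λ u → foldr ℕ._+_ 0 (map (edge-term u) (allFin n))) ⟩
    ∑[ u < n ] (+ foldr ℕ._+_ 0 (map (edge-term u) (allFin n)))
      ≡⟨ sum-cong-≗ (λ u → pos-sum-allFin (edge-term u)) ⟩
    ∑[ u < n ] ∑[ v < n ] (+ edge-term u v)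
      ≡⟨ sum-cong-≗ (λ u → sum-cong-≗ (λ v → pos-if (adj u v) _)) ⟩
    ∑[ u < n ] ∑[ v < n ] (𝟙 (adj u v) * gap u v)
      ≡⟨ ∑-adjacent gap ⟩
    ∑[ u < n ] (nonRoot u * (gap u (parent u) + gap (parent u) u))
      ∎
    where
    open ≡-Reasoning
    edge-term : Fin n → Fin n → ℕ
    edge-term u v = if adj u v then (if does (u <? v) then degree-gap u v else 0) else 0

  parent-gap : ∀ {u} → u ≢ r → + deg G (parent u) - + deg G u ≤ gap u (parent u) + gap (parent u) u
  parent-gap {u} u≢r = begin
    + deg G (parent u) - + deg G u        ≤⟨ n-m≤∣m-n∣ (deg G u) (deg G (parent u)) ⟩
    + degree-gap u (parent u)             ≡⟨ orientation-sum degree-gap degree-gap-sym (parent-≢ u≢r ∘ sym) ⟨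
    gap u (parent u) + gap (parent u) u   ∎
    where
    open ≤-Reasoning
    degree-gap-sym : ∀ u v → degree-gap u v ≡ degree-gap v u
    degree-gap-sym u v = ℕ.∣-∣-comm (deg G u) (deg G v)

  rooted-bound : vertexSum G + + 2 * (+ deg G r - + 2) ≤ + edgeSum G
  rooted-bound = begin
    vertexSum G + + 2 * (+ deg G r - + 2)
      ≡⟨ vertexSum-via-parents ⟩
    ∑[ u < n ] (nonRoot u * (+ deg G (parent u) - + deg G u))
      ≤⟨ ∑-mono-≤ (λ u → nonRoot-mono {u} parent-gap) ⟩
    ∑[ u < n ] (nonRoot u * (gap u (parent u) + gap (parent u) u))
      ≡⟨ edgeSum-via-parents ⟨
    + edgeSum G
      ∎
    where open ≤-Reasoning

maximum-degree-vertex : ∀ {m} (G : Graph (suc m)) → ∃ λ r → ∀ u → deg G u ℕ.≤ deg G r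
maximum-degree-vertex G =
  _ , λ u → All.lookup (f[xs]≤f[argmax] {f = deg G} zero (allFin _)) (∈-allFin u)

maxDeg≤ : ∀ {n} (G : Graph n) {b} → (∀ u → deg G u ℕ.≤ b) → maxDeg G ℕ.≤ b
maxDeg≤ {n} G {b} bound =
  foldr-preservesᵇ {P = ℕ._≤ b} ℕ.⊔-lub z≤n (Allₚ.map⁺ (All.universal bound (allFin n)))

theorem4 : (n : ℕ) → 3 Data.Nat.≤ n → (T : Graph n) → IsTree T →
    + edgeSum T Data.Integer.≥ vertexSum T + (+ 2) * (+ maxDeg T - + 2)
-- The bound holds for every nonempty tree; 3 ≤ n only provides a root.
theorem4 zero    ()
theorem4 (suc m) _ T tree = begin
  vertexSum T + + 2 * (+ maxDeg T - + 2)  ≤⟨ +-monoʳ-≤ (vertexSum T) (*-monoˡ-≤-nonNeg (+ 2) Δ≤d[r]) ⟩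
  vertexSum T + + 2 * (+ deg T r - + 2)   ≤⟨ RootedTree.rooted-bound T tree r ⟩
  + edgeSum T                             ∎
  where
  open ≤-Reasoning
  r = proj₁ (maximum-degree-vertex T)
  Δ≤d[r] : + maxDeg T - + 2 ≤ + deg T r - + 2
  Δ≤d[r] = +-monoˡ-≤ (- + 2) (+≤+ (maxDeg≤ T (proj₂ (maximum-degree-vertex T))))
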